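{- Let $M_i=(Q_i,R_i,X_i,\delta_i)$, $i=1,2,3$, be rough finite state machines. Then (i) $(M_1\times M_2)\times M_3\cong M_1\times(M_2\times M_3)$; (ii) if $X_1=X_2=X_3=X$, then $(M_1\wedge M_2)\wedge M_3\cong M_1\wedge(M_2\wedge M_3)$; (iii) $(M_1\circ M_2)\circ M_3\cong M_1\circ(M_2\circ M_3)$; (iv) for maps $\omega_1:Q_2\times X_2\to X_1$ and $\omega_2:Q_3\times X_3\to X_2$, setting $\omega_4=\omega_2$ and $\omega_3:(Q_2\times Q_3)\times X_3\to X_1$, $\omega_3((q_2,q_3),x_3)=\omega_1(q_2,\omega_2(q_3,x_3))$, one has $(M_1\,\omega_1\,M_2)\,\omega_2\,M_3\cong M_1\,\omega_3\,(M_2\,\omega_4\,M_3)$.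
   Context: For an equivalence relation $R$ on a set $Q$ and $A\subseteq Q$: $\underline{A}=\bigcup\{[q]:[q]\subseteq A\}$, $\overline{A}=\bigcup\{[q]:[q]\cap A\ne\emptyset\}$; a rough set in $(Q,R)$ is a pair $(\underline{A},\overline{A})$ with $A\subseteq Q$. A rough finite state machine (RFSM) is $M=(Q,R,X,\delta)$ with $Q$ nonempty finite, $R$ an equivalence relation on $Q$, $X$ a monoid, and $\delta$ assigning to each $(q,x)\in Q\times X$ a rough set $\delta(q,x)=(\underline{\delta(q,x)},\overline{\delta(q,x)})$ in $(Q,R)$. Homomorphism from $M=(Q,R,X,\delta)$ to $M'=(Q',R',X',\delta')$: a pair of maps $f:Q\to Q'$, $g:X\to X'$ with $(p,q)\in R\Rightarrow(f(p),f(q))\in R'$ and, for all $q\in Q$, $x\in X$, $f(\underline{\delta(q,x)})\subseteq\underline{\delta'(f(q),g(x))}$ and $f(\overline{\delta(q,x)})\subseteq\overline{\delta'(f(q),g(x))}$. An isomorphism is a homomorphism with $f$ and $g$ bijective; $M\cong M'$ means an isomorphism from $M$ to $M'$ exists. $R\times S$ denotes the equivalence on $Q\times P$ with $((p,p'),(q,q'))\in R\times S$ iff $(p,q)\in R$ and $(p',q')\in S$. Products of RFSMs $M=(Q,R,X,\delta)$, $M'=(Q',R',X',\delta')$ (all with state relation $R\times R'$ on $Q\times Q'$): Full direct product $M\times M'$: inputs $X\times X'$ (product monoid), $((q,q'),(x,x'))\mapsto(\underline{\delta(q,x)}\times\underline{\delta'(q',x')},\ \overline{\delta(q,x)}\times\overline{\delta'(q',x')})$.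 Restricted direct product $M\wedge M'$ (when $X=X'$): inputs $X$, $((q,q'),x)\mapsto(\underline{\delta(q,x)}\times\underline{\delta'(q',x)},\ \overline{\delta(q,x)}\times\overline{\delta'(q',x)})$. Wreath product $M\circ M'$: inputs $X^{Q'}\times X'$ ($X^{Q'}$ = maps $Q'\to X$ with pointwise multiplication, componentwise monoid structure), $((q,q'),(f,x'))\mapsto(\underline{\delta(q,f(q'))}\times\underline{\delta'(q',x')},\ \overline{\delta(q,f(q'))}\times\overline{\delta'(q',x')})$. Cascade product $M\,\omega\,M'$ for $\omega:Q'\times X'\to X$: inputs $X'$, $((q,q'),x')\mapsto(\underline{\delta(q,\omega(q',x'))}\times\underline{\delta'(q',x')},\ \overline{\delta(q,\omega(q',x'))}\times\overline{\delta'(q',x')})$. -}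

module Defs where

open import Level using (0ℓ)
open import Data.Nat using (ℕ; _*_)
open import Data.Fin using (Fin)
open import Data.Fin.Properties using (*↔×)
open import Data.Product using (Σ; Σ-syntax; _×_; _,_; proj₁; proj₂)
open import Data.Product.Relation.Binary.Pointwise.NonDependent using (Pointwise; ×-isEquivalence)
open import Data.Product.Function.NonDependent.Propositional using (_×-↔_)
open import Function.Bundles using (_↔_)
open import Function.Properties.Inverse using (↔-trans; ↔-sym)
open import Function.Definitions using (Bijective)
open import Relation.Binary.Core using (Rel)
open import Relation.Binary.Structures using (IsEquivalence)
open import Relation.Binary.PropositionalEquality using (_≡_)
open import Relation.Unary using (Pred; _⊆_; _≐_; _⟨×⟩_)
open import Algebra.Bundles using (Monoid)
import Algebra.Construct.DirectProduct as DP
import Algebra.Construct.Pointwise as PW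

module _ {Q : Set} (R : Rel Q 0ℓ) where

  -- lower approximation:  ⋃ { [p] : [p] ⊆ A }
  lower : Pred Q 0ℓ → Pred Q 0ℓ
  lower A q = Σ[ p ∈ Q ] (R p q × (∀ r → R p r → A r))

  -- upper approximation:  ⋃ { [p] : [p] ∩ A ≠ ∅ }
  upper : Pred Q 0ℓ → Pred Q 0ℓ
  upper A q = Σ[ p ∈ Q ] (R p q × Σ[ r ∈ Q ] (R p r × A r))

record RoughSet {Q : Set} (R : Rel Q 0ℓ) : Set₁ where
  field
    lo    : Pred Q 0ℓ
    up    : Pred Q 0ℓ
    base  : Pred Q 0ℓ
    lo-eq : lo ≐ lower R base
    up-eq : up ≐ upper R base
open RoughSet public

-- Rough finite state machines over an input monoid X.
-- Monoids are stdlib (setoid-based) monoids; δ is required to be a map on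
-- the underlying set, i.e. to respect the monoid's equality.

record RFSM (X : Monoid 0ℓ 0ℓ) : Set₁ where
  open Monoid X using (Carrier; _≈_)
  field
    Q         : Set
    finite    : Σ[ n ∈ ℕ ] (Q ↔ Fin n)
    inhabited : Q
    R         : Rel Q 0ℓ
    R-equiv   : IsEquivalence R
    δ         : Q → Carrier → RoughSet R
    δ-cong    : ∀ q {x y} → x ≈ y →
                (lo (δ q x) ≐ lo (δ q y)) × (up (δ q x) ≐ up (δ q y))
open RFSM public

record Hom {X X' : Monoid 0ℓ 0ℓ} (M : RFSM X) (M' : RFSM X') : Set where
  open Monoid X using () renaming (Carrier to C; _≈_ to _≈_)
  open Monoid X' using () renaming (Carrier to C'; _≈_ to _≈'_)
  field
    f      : Q M → Q M'
    g      : C → C'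
    g-cong : ∀ {x y} → x ≈ y → g x ≈' g y
    R-pres : ∀ {p q} → R M p q → R M' (f p) (f q)
    lo-pres : ∀ q x p → lo (δ M q x) p → lo (δ M' (f q) (g x)) (f p)
    up-pres : ∀ q x p → up (δ M q x) p → up (δ M' (f q) (g x)) (f p)

record _≅_ {X X' : Monoid 0ℓ 0ℓ} (M : RFSM X) (M' : RFSM X') : Set where
  field
    hom   : Hom M M'
    f-bij : Bijective _≡_ _≡_ (Hom.f hom)
    g-bij : Bijective (Monoid._≈_ X) (Monoid._≈_ X') (Hom.g hom)

module _ {Q P : Set} {R : Rel Q 0ℓ} {S : Rel P 0ℓ}
         (eR : IsEquivalence R) (eS : IsEquivalence S) where

  _⊗ʳ_ : RoughSet R → RoughSet S → RoughSet (Pointwise R S)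
  a ⊗ʳ b = record
    { lo = lo a ⟨×⟩ lo b
    ; up = up a ⟨×⟩ up b
    ; base = base a ⟨×⟩ base b
    ; lo-eq = lo→ , lo←
    ; up-eq = up→ , up←
    }
    where
    lo→ : (lo a ⟨×⟩ lo b) ⊆ lower (Pointwise R S) (base a ⟨×⟩ base b)
    lo→ (x , y) with proj₁ (lo-eq a) x | proj₁ (lo-eq b) y
    ... | p , Rpq , hA | p' , Sp'q' , hB =
      (p , p') , (Rpq , Sp'q') , λ { (r , r') (Rpr , Sp'r') → hA r Rpr , hB r' Sp'r' }
    lo← : lower (Pointwise R S) (base a ⟨×⟩ base b) ⊆ (lo a ⟨×⟩ lo b)
    lo← ((p , p') , (Rpq , Sp'q') , h) =
      proj₂ (lo-eq a) (p , Rpq , λ r Rpr → proj₁ (h (r , p') (Rpr , IsEquivalence.refl eS))) ,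
      proj₂ (lo-eq b) (p' , Sp'q' , λ r' s → proj₂ (h (p , r') (IsEquivalence.refl eR , s)))
    up→ : (up a ⟨×⟩ up b) ⊆ upper (Pointwise R S) (base a ⟨×⟩ base b)
    up→ (x , y) with proj₁ (up-eq a) x | proj₁ (up-eq b) y
    ... | p , Rpq , r , Rpr , Ar | p' , Sp'q' , r' , Sp'r' , Br' =
      (p , p') , (Rpq , Sp'q') , (r , r') , (Rpr , Sp'r') , (Ar , Br')
    up← : upper (Pointwise R S) (base a ⟨×⟩ base b) ⊆ (up a ⟨×⟩ up b)
    up← ((p , p') , (Rpq , Sp'q') , (r , r') , (Rpr , Sp'r') , (Ar , Br')) =
      proj₂ (up-eq a) (p , Rpq , r , Rpr , Ar) , proj₂ (up-eq b) (p' , Sp'q' , r' , Sp'r' , Br')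

×-≐ : {Q P : Set} {A A' : Pred Q 0ℓ} {B B' : Pred P 0ℓ} →
      A ≐ A' → B ≐ B' → (A ⟨×⟩ B) ≐ (A' ⟨×⟩ B')
×-≐ (a→ , a←) (b→ , b←) = (λ (x , y) → a→ x , b→ y) , (λ (x , y) → a← x , b← y)

finite-× : {Q P : Set} → Σ[ n ∈ ℕ ] (Q ↔ Fin n) → Σ[ m ∈ ℕ ] (P ↔ Fin m) →
           Σ[ k ∈ ℕ ] ((Q × P) ↔ Fin k)
finite-× (n , e) (m , e') = n * m , ↔-trans (e ×-↔ e') (↔-sym *↔×)

_×ᴹ_ : {X X' : Monoid 0ℓ 0ℓ} → RFSM X → RFSM X' → RFSM (DP.monoid X X')
M ×ᴹ M' = record
  { Q = Q M × Q M'
  ; finite = finite-× (finite M) (finite M')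
  ; inhabited = inhabited M , inhabited M'
  ; R = Pointwise (R M) (R M')
  ; R-equiv = ×-isEquivalence (R-equiv M) (R-equiv M')
  ; δ = λ { (q , q') (x , x') → _⊗ʳ_ (R-equiv M) (R-equiv M') (δ M q x) (δ M' q' x') }
  ; δ-cong = λ { (q , q') (e , e') →
      ×-≐ (proj₁ (δ-cong M q e)) (proj₁ (δ-cong M' q' e')) ,
      ×-≐ (proj₂ (δ-cong M q e)) (proj₂ (δ-cong M' q' e')) }
  }

_∧ᴹ_ : {X : Monoid 0ℓ 0ℓ} → RFSM X → RFSM X → RFSM X
M ∧ᴹ M' = record
  { Q = Q M × Q M'
  ; finite = finite-× (finite M) (finite M')
  ; inhabited = inhabited M , inhabited M'
  ; R = Pointwise (R M) (R M')
  ; R-equiv = ×-isEquivalence (R-equiv M) (R-equiv M')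
  ; δ = λ { (q , q') x → _⊗ʳ_ (R-equiv M) (R-equiv M') (δ M q x) (δ M' q' x) }
  ; δ-cong = λ { (q , q') e →
      ×-≐ (proj₁ (δ-cong M q e)) (proj₁ (δ-cong M' q' e)) ,
      ×-≐ (proj₂ (δ-cong M q e)) (proj₂ (δ-cong M' q' e)) }
  }

wreathMonoid : {X' : Monoid 0ℓ 0ℓ} (X : Monoid 0ℓ 0ℓ) → RFSM X' → Monoid 0ℓ 0ℓ
wreathMonoid {X'} X M' = DP.monoid (PW.monoid (Q M') X) X'

_∘ᴹ_ : {X X' : Monoid 0ℓ 0ℓ} (M : RFSM X) (M' : RFSM X') → RFSM (wreathMonoid X M')
M ∘ᴹ M' = record
  { Q = Q M × Q M'
  ; finite = finite-× (finite M) (finite M')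
  ; inhabited = inhabited M , inhabited M'
  ; R = Pointwise (R M) (R M')
  ; R-equiv = ×-isEquivalence (R-equiv M) (R-equiv M')
  ; δ = λ { (q , q') (h , x') → _⊗ʳ_ (R-equiv M) (R-equiv M') (δ M q (h q')) (δ M' q' x') }
  ; δ-cong = λ { (q , q') (e , e') →
      ×-≐ (proj₁ (δ-cong M q (e q'))) (proj₁ (δ-cong M' q' e')) ,
      ×-≐ (proj₂ (δ-cong M q (e q'))) (proj₂ (δ-cong M' q' e')) }
  }

record Connector {X' : Monoid 0ℓ 0ℓ} (X : Monoid 0ℓ 0ℓ) (M' : RFSM X') : Set where
  field
    ω      : Q M' → Monoid.Carrier X' → Monoid.Carrier X
    ω-cong : ∀ q' {x y} → Monoid._≈_ X' x y → Monoid._≈_ X (ω q' x) (ω q' y)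
open Connector public

cascade : {X X' : Monoid 0ℓ 0ℓ} (M : RFSM X) (M' : RFSM X') → Connector X M' → RFSM X'
cascade M M' c = record
  { Q = Q M × Q M'
  ; finite = finite-× (finite M) (finite M')
  ; inhabited = inhabited M , inhabited M'
  ; R = Pointwise (R M) (R M')
  ; R-equiv = ×-isEquivalence (R-equiv M) (R-equiv M')
  ; δ = λ { (q , q') x' → _⊗ʳ_ (R-equiv M) (R-equiv M') (δ M q (ω c q' x')) (δ M' q' x') }
  ; δ-cong = λ { (q , q') e →
      ×-≐ (proj₁ (δ-cong M q (ω-cong c q' e))) (proj₁ (δ-cong M' q' e)) ,
      ×-≐ (proj₂ (δ-cong M q (ω-cong c q' e))) (proj₂ (δ-cong M' q' e)) }
  }

compose-ω : {X₁ X₂ X₃ : Monoid 0ℓ 0ℓ} {M₂ : RFSM X₂} {M₃ : RFSM X₃} →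
            (ω₁ : Connector X₁ M₂) (ω₂ : Connector X₂ M₃) →
            Connector X₁ (cascade M₂ M₃ ω₂)
compose-ω ω₁ ω₂ = record
  { ω = λ { (q₂ , q₃) x₃ → ω ω₁ q₂ (ω ω₂ q₃ x₃) }
  ; ω-cong = λ { (q₂ , q₃) e → ω-cong ω₁ q₂ (ω-cong ω₂ q₃ e) }
  }

-- All four products are built on the same state space Q₁ × Q₂ × Q₃ with the
-- product relation and product rough sets, so in each case the state map is
-- the reassociation ((q₁ , q₂) , q₃) ↦ (q₁ , (q₂ , q₃)), under which both
-- machines make literally the same transitions. Only the input map differs:
-- the identity for the restricted and cascade products, reassociation for the
-- full direct product, and currying Q₃ → X₁^Q₂ × X₂ into X₁^(Q₂×Q₃) × X₂^Q₃
-- for the wreath product. Each input map is bijective because it has a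
-- two-sided inverse and both directions respect the input equalities.
module Submission where

open import Defs
open import Level using (0ℓ)
open import Data.Product using (_×_; _,_; proj₁; proj₂; assocʳ′; assocˡ′)
open import Algebra.Bundles using (Monoid)
open import Function.Base using (id)
open import Function.Definitions using (Bijective; Congruent)
import Function.Construct.Identity as Identity
import Algebra.Construct.DirectProduct as DP
import Algebra.Construct.Pointwise as PW
open import Relation.Binary.Core using (Rel)
open import Relation.Binary.PropositionalEquality using (_≡_; refl; cong; subst; subst₂)

module _ {A B : Set} {_≈₁_ : Rel A 0ℓ} {_≈₂_ : Rel B 0ℓ} {f : A → B} where

  congruent-inverse⇒bijective : (f⁻¹ : B → A) →
    Congruent _≈₁_ _≈₂_ f → Congruent _≈₂_ _≈₁_ f⁻¹ →
    (∀ x → f⁻¹ (f x) ≡ x) → (∀ y → f (f⁻¹ y) ≡ y) →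
    Bijective _≈₁_ _≈₂_ f
  congruent-inverse⇒bijective f⁻¹ f-cong f⁻¹-cong f⁻¹∘f f∘f⁻¹ =
    (λ {x} {y} fx≈fy → subst₂ _≈₁_ (f⁻¹∘f x) (f⁻¹∘f y) (f⁻¹-cong fx≈fy)) ,
    (λ y → f⁻¹ y , λ {z} z≈f⁻¹y → subst (f z ≈₂_) (f∘f⁻¹ y) (f-cong z≈f⁻¹y))

assocʳ′-bijective : {A B C : Set} → Bijective _≡_ _≡_ (assocʳ′ {A = A} {B = B} {C = C})
assocʳ′-bijective =
  congruent-inverse⇒bijective assocˡ′ (cong assocʳ′) (cong assocˡ′) (λ _ → refl) (λ _ → refl)

-- Pointwise, ⟨×⟩ and the product-monoid equality unfold (by η for pairs) to
-- nested products of the component facts, so reassociating the proof itself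
-- transports relatedness, membership in the approximations and input equality.
×ᴹ-assoc : ∀ {X₁ X₂ X₃ : Monoid 0ℓ 0ℓ} (M₁ : RFSM X₁) (M₂ : RFSM X₂) (M₃ : RFSM X₃) →
           ((M₁ ×ᴹ M₂) ×ᴹ M₃) ≅ (M₁ ×ᴹ (M₂ ×ᴹ M₃))
×ᴹ-assoc M₁ M₂ M₃ = record
  { hom = record
    { f = assocʳ′
    ; g = assocʳ′
    ; g-cong = assocʳ′
    ; R-pres = assocʳ′
    ; lo-pres = λ _ _ _ → assocʳ′
    ; up-pres = λ _ _ _ → assocʳ′
    }
  ; f-bij = assocʳ′-bijective
  ; g-bij = congruent-inverse⇒bijective assocˡ′ assocʳ′ assocˡ′ (λ _ → refl) (λ _ → refl)
  }

∧ᴹ-assoc : ∀ {X : Monoid 0ℓ 0ℓ} (M₁ M₂ M₃ : RFSM X) →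
           ((M₁ ∧ᴹ M₂) ∧ᴹ M₃) ≅ (M₁ ∧ᴹ (M₂ ∧ᴹ M₃))
∧ᴹ-assoc {X} M₁ M₂ M₃ = record
  { hom = record
    { f = assocʳ′
    ; g = id
    ; g-cong = id
    ; R-pres = assocʳ′
    ; lo-pres = λ _ _ _ → assocʳ′
    ; up-pres = λ _ _ _ → assocʳ′
    }
  ; f-bij = assocʳ′-bijective
  ; g-bij = Identity.bijective (Monoid._≈_ X)
  }

module WreathInput (Q₂ Q₃ : Set) (X₁ X₂ X₃ : Monoid 0ℓ 0ℓ) where

  nested flat : Monoid 0ℓ 0ℓ
  nested = DP.monoid (PW.monoid Q₃ (DP.monoid (PW.monoid Q₂ X₁) X₂)) X₃
  flat = DP.monoid (PW.monoid (Q₂ × Q₃) X₁) (DP.monoid (PW.monoid Q₃ X₂) X₃)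

  open Monoid nested using () renaming (Carrier to Nested; _≈_ to _≈ₙ_)
  open Monoid flat using () renaming (Carrier to Flat; _≈_ to _≈ᶠ_)

  assocʳ : Nested → Flat
  assocʳ (h , x₃) = (λ (q₂ , q₃) → proj₁ (h q₃) q₂) , ((λ q₃ → proj₂ (h q₃)) , x₃)

  assocˡ : Flat → Nested
  assocˡ (h , (k , x₃)) = (λ q₃ → (λ q₂ → h (q₂ , q₃)) , k q₃) , x₃

  assocʳ-cong : Congruent _≈ₙ_ _≈ᶠ_ assocʳ
  assocʳ-cong {_ , _} {_ , _} (h≈ , x₃≈) =
    (λ (q₂ , q₃) → proj₁ (h≈ q₃) q₂) , ((λ q₃ → proj₂ (h≈ q₃)) , x₃≈)

  assocˡ-cong : Congruent _≈ᶠ_ _≈ₙ_ assocˡ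
  assocˡ-cong {_ , (_ , _)} {_ , (_ , _)} (h≈ , (k≈ , x₃≈)) =
    (λ q₃ → (λ q₂ → h≈ (q₂ , q₃)) , k≈ q₃) , x₃≈

  assocʳ-bijective : Bijective _≈ₙ_ _≈ᶠ_ assocʳ
  assocʳ-bijective =
    congruent-inverse⇒bijective {_≈₁_ = _≈ₙ_} {_≈₂_ = _≈ᶠ_} assocˡ assocʳ-cong assocˡ-cong
      (λ _ → refl) (λ _ → refl)

∘ᴹ-assoc : ∀ {X₁ X₂ X₃ : Monoid 0ℓ 0ℓ} (M₁ : RFSM X₁) (M₂ : RFSM X₂) (M₃ : RFSM X₃) →
           ((M₁ ∘ᴹ M₂) ∘ᴹ M₃) ≅ (M₁ ∘ᴹ (M₂ ∘ᴹ M₃))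
∘ᴹ-assoc {X₁} {X₂} {X₃} M₁ M₂ M₃ = record
  { hom = record
    { f = assocʳ′
    ; g = assocʳ
    ; g-cong = assocʳ-cong
    ; R-pres = assocʳ′
    ; lo-pres = λ _ _ _ → assocʳ′
    ; up-pres = λ _ _ _ → assocʳ′
    }
  ; f-bij = assocʳ′-bijective
  ; g-bij = assocʳ-bijective
  }
  where open WreathInput (Q M₂) (Q M₃) X₁ X₂ X₃

cascade-assoc : ∀ {X₁ X₂ X₃ : Monoid 0ℓ 0ℓ} (M₁ : RFSM X₁) (M₂ : RFSM X₂) (M₃ : RFSM X₃)
                (ω₁ : Connector X₁ M₂) (ω₂ : Connector X₂ M₃) →
                cascade (cascade M₁ M₂ ω₁) M₃ ω₂ ≅ cascade M₁ (cascade M₂ M₃ ω₂) (compose-ω ω₁ ω₂)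
cascade-assoc {X₃ = X₃} M₁ M₂ M₃ ω₁ ω₂ = record
  { hom = record
    { f = assocʳ′
    ; g = id
    ; g-cong = id
    ; R-pres = assocʳ′
    ; lo-pres = λ _ _ _ → assocʳ′
    ; up-pres = λ _ _ _ → assocʳ′
    }
  ; f-bij = assocʳ′-bijective
  ; g-bij = Identity.bijective (Monoid._≈_ X₃)
  }

proposition3p4 : (∀ {X₁ X₂ X₃ : Monoid 0ℓ 0ℓ} (M₁ : RFSM X₁) (M₂ : RFSM X₂) (M₃ : RFSM X₃) →
    ((M₁ ×ᴹ M₂) ×ᴹ M₃) ≅ (M₁ ×ᴹ (M₂ ×ᴹ M₃)))
    × (∀ {X : Monoid 0ℓ 0ℓ} (M₁ M₂ M₃ : RFSM X) →
    ((M₁ ∧ᴹ M₂) ∧ᴹ M₃) ≅ (M₁ ∧ᴹ (M₂ ∧ᴹ M₃)))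
    × (∀ {X₁ X₂ X₃ : Monoid 0ℓ 0ℓ} (M₁ : RFSM X₁) (M₂ : RFSM X₂) (M₃ : RFSM X₃) →
    ((M₁ ∘ᴹ M₂) ∘ᴹ M₃) ≅ (M₁ ∘ᴹ (M₂ ∘ᴹ M₃)))
    × (∀ {X₁ X₂ X₃ : Monoid 0ℓ 0ℓ} (M₁ : RFSM X₁) (M₂ : RFSM X₂) (M₃ : RFSM X₃)
    (ω₁ : Connector X₁ M₂) (ω₂ : Connector X₂ M₃) →
    cascade (cascade M₁ M₂ ω₁) M₃ ω₂
    ≅ cascade M₁ (cascade M₂ M₃ ω₂) (compose-ω ω₁ ω₂))
proposition3p4 = ×ᴹ-assoc , ∧ᴹ-assoc , ∘ᴹ-assoc , cascade-assoc
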